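{- Let $r\geq 2$. Let $\mathcal{G}$ be an $r$-graph with $s$ vertices and let $S$ be a set of degree-$1$ vertices of $\mathcal{G}$. Let $\mathcal{F}$ be an $r$-graph. If there is an injective map $f:V(\mathcal{G})\setminus S\to V(\mathcal{F})$ such that $f(E\setminus S)\in\mathrm{Ker}_s(\mathcal{F})$ for every edge $E\in\mathcal{G}$, then $\mathcal{F}$ contains a copy of $\mathcal{G}$.
   Context: A family of sets forms an $s$-star with kernel $D$ if any two of them intersect exactly in $D$ and each contains an element outside $D$ ($D=\emptyset$ allowed). The kernel degree $\deg^*_{\mathcal{F}}(D)$ is the maximum $s$ such that $\mathcal{F}$ contains an $s$-star with kernel $D$, and $\mathrm{Ker}_s(\mathcal{F})=\{D\subseteq V(\mathcal{F}):\deg^*_{\mathcal{F}}(D)\geq s\}$. (The paper phrases the hypothesis as $\mathcal{G}-S\subseteq\mathrm{Ker}_s(\mathcal{F})$, where $\mathcal{G}-S=\{E\setminus S:E\in\mathcal{G}\}$.) -}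

module Defs where

open import Data.Nat using (ℕ; _≥_)
open import Data.Fin using (Fin; _≟_)
open import Data.Fin.Properties using (any?)
open import Data.Fin.Subset using (Subset; _∈_; _∉_; _∩_; _─_; _⊆_; ∣_∣)
open import Data.Fin.Subset.Properties using (_∈?_)
open import Data.Vec using (tabulate)
open import Data.List using (List; filter; length)
open import Data.List.Membership.Propositional using () renaming (_∈_ to _∈ₗ_)
open import Data.List.Relation.Unary.Unique.Propositional using (Unique)
open import Data.Product using (Σ; ∃; _×_; _,_)
open import Relation.Nullary using (¬_; does)
open import Relation.Nullary.Decidable using (_×-dec_)
open import Relation.Binary.PropositionalEquality using (_≡_)

record Graph (r n : ℕ) : Set where
  field
    edges      : List (Subset n)
    edgesUniq  : Unique edges
    edgeSize   : ∀ {E} → E ∈ₗ edges → ∣ E ∣ ≡ r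
open Graph public

degree : ∀ {r n} → Graph r n → Fin n → ℕ
degree G v = length (filter (v ∈?_) (edges G))

image : ∀ {n m} → (Fin n → Fin m) → Subset n → Subset m
image f A = tabulate (λ y → does (any? (λ v → (v ∈? A) ×-dec (f v ≟ y))))

record Star {r m : ℕ} (F : Graph r m) (k : ℕ) (D : Subset m) : Set where
  field
    petal       : Fin k → Subset m
    petalEdge   : ∀ i → petal i ∈ₗ edges F
    kernelSub   : ∀ i → D ⊆ petal i
    pairwise    : ∀ i j → ¬ (i ≡ j) → petal i ∩ petal j ≡ D
    outside     : ∀ i → ∃ λ x → x ∈ petal i × x ∉ D

-- D ∈ Ker_s(F)  iff  deg*_F(D) ≥ s, i.e. F contains a k-star with kernel D for some k ≥ s
-- (deg* is the maximum such k, which exists since F is finite).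
InKer : ∀ {r m} → ℕ → Graph r m → Subset m → Set
InKer s F D = Σ ℕ λ k → k ≥ s × Star F k D

ContainsCopy : ∀ {r n m} → Graph r m → Graph r n → Set
ContainsCopy {n = n} {m} F G =
  Σ (Fin n → Fin m) λ φ →
    (∀ u v → φ u ≡ φ v → u ≡ v) × (∀ E → E ∈ₗ edges G → image φ E ∈ₗ edges F)

module Submission where

-- Proof of Proposition 5.3: the edges of G are embedded one at a time.
--
-- After processing a list Ls of edges we hold a map φ : V(G) → V(F) that agrees
-- with f outside S, is injective on the vertices covered so far (those outside S
-- and those lying in an edge of Ls), and sends every edge of Ls onto an edge of F.
-- To add an edge E, let D = f(E ∖ S); it is the kernel of a star of F with at
-- least s petals.  Outside D the petals are pairwise disjoint, and the only
-- covered vertices that φ may send outside D lie outside E, so there are fewer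
-- than s of them; by pigeonhole some petal P ⊇ D contains no such image.  Since
-- |E ∩ S| ≤ |P ∖ D|, re-routing E ∩ S injectively into P ∖ D maps E onto P.  As
-- the vertices of S have degree 1, no vertex of E ∩ S was covered before, so the
-- re-routing does not disturb the edges already embedded.

open import Defs
open import Data.Nat using (ℕ; zero; suc; _+_; _≤_; _<_; _≥_; z≤n; s≤s; s≤s⁻¹)
open import Data.Nat.Properties
  using (≤-trans; ≤-reflexive; <⇒≱; n≮0; n≤1+n; +-comm; +-monoˡ-≤; +-suc; +-cancelʳ-≤; ∸-monoʳ-<;
         module ≤-Reasoning)
open import Data.Bool using (true)
open import Data.Vec using (_∷_; [])
open import Data.Vec.Properties using (lookup∘tabulate; []=⇒lookup; lookup⇒[]=)
open import Data.Fin using (Fin; zero; suc; _≟_)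
open import Data.Fin.Properties using (any?; all?; ¬∀⟶∃¬; suc-injective; 0≢1+n)
open import Data.Fin.Subset
  using (Subset; _∈_; _∉_; _─_; _-_; _∩_; _⊆_; ∣_∣; ⊤; ∁; ⁅_⁆; Nonempty; inside; outside)
open import Data.Fin.Subset.Properties
  using (_∈?_; x∈⁅x⁆; p─⊥≡p; p─q⊆p; x∈p∧x∉q⇒x∈p─q; x∈p∧x≢y⇒x∈p-y; x∈p∩q⁺; x∈p∩q⁻; x∉p⇒x∈∁p;
         ∣⊤∣≡n; ∣p∣≤n; ∣∁p∣≡n∸∣p∣; ∣p∩q∣≤∣q∣; p⊂q⇒∣p∣<∣q∣; x∈p⇒∣p-x∣<∣p∣; ⊆-antisym)
open import Data.Vec.Base using (here; there)
open import Data.List using (List; []; _∷_; filter; length)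
open import Data.List.Properties using (filter-accept)
open import Data.List.Relation.Unary.Any using (Any; here; there)
open import Data.List.Membership.Propositional using (lose) renaming (_∈_ to _∈ₗ_)
open import Data.Product using (Σ; ∃; _×_; _,_; proj₁; proj₂)
open import Data.Sum using (_⊎_; inj₁; inj₂)
open import Data.Empty using (⊥-elim)
open import Relation.Nullary using (¬_; Dec; does; yes; no; ¬?)
open import Relation.Nullary.Decidable using (_×-dec_)
open import Relation.Binary.PropositionalEquality

InjectiveOn : ∀ {n m} → (Fin n → Set) → (Fin n → Fin m) → Set
InjectiveOn X φ = ∀ u v → X u → X v → φ u ≡ φ v → u ≡ v

injectiveOn-⊎ : ∀ {n m} {X Y : Fin n → Set} (φ : Fin n → Fin m) →
  InjectiveOn X φ → InjectiveOn Y φ → (∀ u v → X u → Y v → φ u ≢ φ v) →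
  InjectiveOn (λ v → X v ⊎ Y v) φ
injectiveOn-⊎ φ injX injY apart u v (inj₁ xu) (inj₁ xv) eq = injX u v xu xv eq
injectiveOn-⊎ φ injX injY apart u v (inj₂ yu) (inj₂ yv) eq = injY u v yu yv eq
injectiveOn-⊎ φ injX injY apart u v (inj₁ xu) (inj₂ yv) eq = ⊥-elim (apart u v xu yv eq)
injectiveOn-⊎ φ injX injY apart u v (inj₂ yu) (inj₁ xv) eq = ⊥-elim (apart v u xv yu (sym eq))

∣p∣≡1+∣p-x∣ : ∀ {n} {x : Fin n} (p : Subset n) → x ∈ p → ∣ p ∣ ≡ suc ∣ p - x ∣
∣p∣≡1+∣p-x∣ {x = zero}  (inside ∷ p)  here      = cong (λ q → suc ∣ q ∣) (sym (p─⊥≡p p))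
∣p∣≡1+∣p-x∣ {x = suc x} (inside ∷ p)  (there i) = cong suc (∣p∣≡1+∣p-x∣ p i)
∣p∣≡1+∣p-x∣ {x = suc x} (outside ∷ p) (there i) = ∣p∣≡1+∣p-x∣ p i

∣p∣≡∣p∩q∣+∣p─q∣ : ∀ {n} (p q : Subset n) → ∣ p ∣ ≡ ∣ p ∩ q ∣ + ∣ p ─ q ∣
∣p∣≡∣p∩q∣+∣p─q∣ []            []            = refl
∣p∣≡∣p∩q∣+∣p─q∣ (inside ∷ p)  (inside ∷ q)  = cong suc (∣p∣≡∣p∩q∣+∣p─q∣ p q)
∣p∣≡∣p∩q∣+∣p─q∣ (inside ∷ p)  (outside ∷ q) =
  trans (cong suc (∣p∣≡∣p∩q∣+∣p─q∣ p q)) (sym (+-suc _ _))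
∣p∣≡∣p∩q∣+∣p─q∣ (outside ∷ p) (inside ∷ q)  = ∣p∣≡∣p∩q∣+∣p─q∣ p q
∣p∣≡∣p∩q∣+∣p─q∣ (outside ∷ p) (outside ∷ q) = ∣p∣≡∣p∩q∣+∣p─q∣ p q

∣p∣>0⇒nonempty : ∀ {n} (p : Subset n) → 0 < ∣ p ∣ → Nonempty p
∣p∣>0⇒nonempty (inside ∷ p)  _   = zero , here
∣p∣>0⇒nonempty (outside ∷ p) pos with ∣p∣>0⇒nonempty p pos
... | x , x∈p = suc x , there x∈p

x∈p─q⇒x∉q : ∀ {n} {x : Fin n} (p q : Subset n) → x ∈ p ─ q → x ∉ q
x∈p─q⇒x∉q (_ ∷ p) (inside ∷ q)  ()        here
x∈p─q⇒x∉q (_ ∷ p) (outside ∷ q) here      ()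
x∈p─q⇒x∉q (_ ∷ p) (_ ∷ q)       (there i) (there j) = x∈p─q⇒x∉q p q i j

x∈p-y⇒x≢y : ∀ {n} {x y : Fin n} (p : Subset n) → x ∈ p - y → x ≢ y
x∈p-y⇒x≢y {y = y} p x∈p-y refl = x∈p─q⇒x∉q p ⁅ y ⁆ x∈p-y (x∈⁅x⁆ y)

⊆∧∣≥∣⇒≡ : ∀ {n} {p q : Subset n} → p ⊆ q → ∣ q ∣ ≤ ∣ p ∣ → p ≡ q
⊆∧∣≥∣⇒≡ {p = p} {q} p⊆q ∣q∣≤∣p∣ = ⊆-antisym p⊆q q⊆p
  where
  q⊆p : q ⊆ p
  q⊆p {x} x∈q with x ∈? p
  ... | yes x∈p = x∈p
  ... | no  x∉p = ⊥-elim (<⇒≱ (p⊂q⇒∣p∣<∣q∣ (p⊆q , x , x∈q , x∉p)) ∣q∣≤∣p∣)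

injection⇒∣≤∣ : ∀ {n m} (A : Subset n) (B : Subset m) (g : ∀ v → v ∈ A → Fin m) →
  (∀ v p → g v p ∈ B) → (∀ u v p q → g u p ≡ g v q → u ≡ v) → ∣ A ∣ ≤ ∣ B ∣
injection⇒∣≤∣ []            B g into inj = z≤n
injection⇒∣≤∣ (outside ∷ A) B g into inj =
  injection⇒∣≤∣ A B (λ v p → g (suc v) (there p)) (λ v p → into (suc v) (there p))
    (λ u v p q eq → suc-injective (inj (suc u) (suc v) (there p) (there q) eq))
injection⇒∣≤∣ (inside ∷ A)  B g into inj =
  ≤-trans (s≤s (injection⇒∣≤∣ A (B - g zero here) (λ v p → g (suc v) (there p)) intoRest
                  (λ u v p q eq → suc-injective (inj (suc u) (suc v) (there p) (there q) eq))))
          (x∈p⇒∣p-x∣<∣p∣ (into zero here))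
  where
  intoRest : ∀ v p → g (suc v) (there p) ∈ B - g zero here
  intoRest v p = x∈p∧x≢y⇒x∈p-y (into (suc v) (there p))
                   (λ eq → 0≢1+n (sym (inj (suc v) zero (there p) here eq)))

record RerouteInto {n m} (A : Subset n) (B : Subset m) (φ ψ : Fin n → Fin m) : Set where
  field
    unchangedOff : ∀ v → v ∉ A → ψ v ≡ φ v
    mapsInto     : ∀ v → v ∈ A → ψ v ∈ B
    injectiveOnA : InjectiveOn (_∈ A) ψ

rerouteInto : ∀ {n m} (A : Subset n) (B : Subset m) → ∣ A ∣ ≤ ∣ B ∣ → (φ : Fin n → Fin m) →
  Σ (Fin n → Fin m) (RerouteInto A B φ)
rerouteInto [] B _ φ = φ , record { unchangedOff = λ () ; mapsInto = λ () ; injectiveOnA = λ () }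
rerouteInto (outside ∷ A) B ∣A∣≤∣B∣ φ with rerouteInto A B ∣A∣≤∣B∣ (λ v → φ (suc v))
... | ψ , rr = ψ' , record { unchangedOff = unchanged ; mapsInto = into ; injectiveOnA = inj }
  where
  open RerouteInto rr
  ψ' : Fin _ → Fin _
  ψ' zero    = φ zero
  ψ' (suc v) = ψ v
  unchanged : ∀ v → v ∉ outside ∷ A → ψ' v ≡ φ v
  unchanged zero    _   = refl
  unchanged (suc v) v∉A = unchangedOff v (λ v∈A → v∉A (there v∈A))
  into : ∀ v → v ∈ outside ∷ A → ψ' v ∈ B
  into (suc v) (there v∈A) = mapsInto v v∈A
  inj : InjectiveOn (_∈ outside ∷ A) ψ'
  inj (suc u) (suc v) (there u∈A) (there v∈A) eq = cong suc (injectiveOnA u v u∈A v∈A eq)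
rerouteInto (inside ∷ A) B ∣A∣<∣B∣ φ with ∣p∣>0⇒nonempty B (≤-trans (s≤s z≤n) ∣A∣<∣B∣)
... | b , b∈B with rerouteInto A (B - b) ∣A∣≤∣B-b∣ (λ v → φ (suc v))
  where
  ∣A∣≤∣B-b∣ : ∣ A ∣ ≤ ∣ B - b ∣
  ∣A∣≤∣B-b∣ = s≤s⁻¹ (≤-trans ∣A∣<∣B∣ (≤-reflexive (∣p∣≡1+∣p-x∣ B b∈B)))
... | ψ , rr = ψ' , record { unchangedOff = unchanged ; mapsInto = into ; injectiveOnA = inj }
  where
  open RerouteInto rr
  ψ' : Fin _ → Fin _
  ψ' zero    = b
  ψ' (suc v) = ψ v
  unchanged : ∀ v → v ∉ inside ∷ A → ψ' v ≡ φ v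
  unchanged zero    v∉A = ⊥-elim (v∉A here)
  unchanged (suc v) v∉A = unchangedOff v (λ v∈A → v∉A (there v∈A))
  into : ∀ v → v ∈ inside ∷ A → ψ' v ∈ B
  into zero    here        = b∈B
  into (suc v) (there v∈A) = p─q⊆p B ⁅ b ⁆ (mapsInto v v∈A)
  inj : InjectiveOn (_∈ inside ∷ A) ψ'
  inj zero    zero    _           _           _  = refl
  inj zero    (suc v) _           (there v∈A) eq = ⊥-elim (x∈p-y⇒x≢y B (mapsInto v v∈A) (sym eq))
  inj (suc u) zero    (there u∈A) _           eq = ⊥-elim (x∈p-y⇒x≢y B (mapsInto u u∈A) eq)
  inj (suc u) (suc v) (there u∈A) (there v∈A) eq = cong suc (injectiveOnA u v u∈A v∈A eq)

module _ {n m : ℕ} (φ : Fin n → Fin m) (A : Subset n) where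
  private
    hit? : (y : Fin m) → Dec (∃ λ v → v ∈ A × φ v ≡ y)
    hit? y = any? (λ v → (v ∈? A) ×-dec (φ v ≟ y))

  image-intro : ∀ v → v ∈ A → φ v ∈ image φ A
  image-intro v v∈A = lookup⇒[]= (φ v) (image φ A) (trans (lookup∘tabulate _ (φ v)) (hit (hit? (φ v))))
    where
    hit : (d : Dec (∃ λ u → u ∈ A × φ u ≡ φ v)) → does d ≡ true
    hit (yes _) = refl
    hit (no  h) = ⊥-elim (h (v , v∈A , refl))

  image-elim : ∀ y → y ∈ image φ A → ∃ λ v → v ∈ A × φ v ≡ y
  image-elim y y∈img = preimage (hit? y) (trans (sym (lookup∘tabulate _ y)) ([]=⇒lookup y∈img))
    where
    preimage : (d : Dec (∃ λ u → u ∈ A × φ u ≡ y)) → does d ≡ true → ∃ λ v → v ∈ A × φ v ≡ y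
    preimage (yes w) _ = w
    preimage (no  _) ()

image-cong : ∀ {n m} (φ ψ : Fin n → Fin m) (A : Subset n) → (∀ v → v ∈ A → φ v ≡ ψ v) →
  image φ A ≡ image ψ A
image-cong φ ψ A agree = ⊆-antisym (transfer φ ψ agree) (transfer ψ φ (λ v p → sym (agree v p)))
  where
  transfer : ∀ φ ψ → (∀ v → v ∈ A → φ v ≡ ψ v) → image φ A ⊆ image ψ A
  transfer φ ψ agree {y} y∈img with image-elim φ A y y∈img
  ... | v , v∈A , refl = subst (_∈ image ψ A) (sym (agree v v∈A)) (image-intro ψ A v v∈A)

∣image∣≤ : ∀ {n m} (φ : Fin n → Fin m) (A : Subset n) → ∣ image φ A ∣ ≤ ∣ A ∣
∣image∣≤ φ A = injection⇒∣≤∣ (image φ A) A (λ y p → proj₁ (image-elim φ A y p))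
  (λ y p → proj₁ (proj₂ (image-elim φ A y p)))
  (λ y z p q eq → trans (sym (proj₂ (proj₂ (image-elim φ A y p))))
                        (trans (cong φ eq) (proj₂ (proj₂ (image-elim φ A z q)))))

∣image∣≥ : ∀ {n m} (φ : Fin n → Fin m) (A : Subset n) → InjectiveOn (_∈ A) φ → ∣ A ∣ ≤ ∣ image φ A ∣
∣image∣≥ φ A inj = injection⇒∣≤∣ A (image φ A) (λ v _ → φ v) (image-intro φ A) inj

image-onto : ∀ {n m} (φ : Fin n → Fin m) (E : Subset n) (P : Subset m) →
  InjectiveOn (_∈ E) φ → (∀ v → v ∈ E → φ v ∈ P) → ∣ P ∣ ≤ ∣ E ∣ → image φ E ≡ P
image-onto φ E P inj into ∣P∣≤∣E∣ = ⊆∧∣≥∣⇒≡ img⊆P (≤-trans ∣P∣≤∣E∣ (∣image∣≥ φ E inj))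
  where
  img⊆P : image φ E ⊆ P
  img⊆P {y} y∈img with image-elim φ E y y∈img
  ... | v , v∈E , refl = into v v∈E

roomForRerouting : ∀ {n m} (φ : Fin n → Fin m) (E S : Subset n) (P : Subset m) → ∣ E ∣ ≡ ∣ P ∣ →
  ∣ E ∩ S ∣ ≤ ∣ P ─ image φ (E ─ S) ∣
roomForRerouting φ E S P ∣E∣≡∣P∣ = +-cancelʳ-≤ (∣ E ─ S ∣) (∣ E ∩ S ∣) (∣ P ─ D ∣) (begin
  ∣ E ∩ S ∣ + ∣ E ─ S ∣  ≡⟨ sym (∣p∣≡∣p∩q∣+∣p─q∣ E S) ⟩
  ∣ E ∣                  ≡⟨ ∣E∣≡∣P∣ ⟩
  ∣ P ∣                  ≡⟨ ∣p∣≡∣p∩q∣+∣p─q∣ P D ⟩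
  ∣ P ∩ D ∣ + ∣ P ─ D ∣  ≤⟨ +-monoˡ-≤ (∣ P ─ D ∣) (≤-trans (∣p∩q∣≤∣q∣ P D) (∣image∣≤ φ (E ─ S))) ⟩
  ∣ E ─ S ∣ + ∣ P ─ D ∣  ≡⟨ +-comm (∣ E ─ S ∣) (∣ P ─ D ∣) ⟩
  ∣ P ─ D ∣ + ∣ E ─ S ∣  ∎)
  where
  open ≤-Reasoning
  D = image φ (E ─ S)

-- Pigeonhole for stars: outside the kernel the petals are pairwise disjoint, so a
-- set U of fewer points than petals cannot meet every petal outside the kernel.
module _ {r n m k : ℕ} {F : Graph r m} {D : Subset m} (st : Star F k D) (h : Fin n → Fin m)
         (U : Subset n) where
  open Star st

  Blocked : Fin k → Set
  Blocked i = ∃ λ u → u ∈ U × h u ∈ petal i × h u ∉ D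

  blocked? : ∀ i → Dec (Blocked i)
  blocked? i = any? (λ u → (u ∈? U) ×-dec ((h u ∈? petal i) ×-dec ¬? (h u ∈? D)))

  -- distinct blocked petals are blocked by distinct points
  allBlocked⇒k≤∣U∣ : (∀ i → Blocked i) → k ≤ ∣ U ∣
  allBlocked⇒k≤∣U∣ blocked = subst (_≤ ∣ U ∣) (∣⊤∣≡n k)
    (injection⇒∣≤∣ ⊤ U (λ i _ → blocker i) (λ i _ → proj₁ (proj₂ (blocked i))) distinct)
    where
    blocker : Fin k → Fin n
    blocker i = proj₁ (blocked i)
    inPetal : ∀ i → h (blocker i) ∈ petal i
    inPetal i = proj₁ (proj₂ (proj₂ (blocked i)))
    distinct : ∀ i j → i ∈ ⊤ → j ∈ ⊤ → blocker i ≡ blocker j → i ≡ j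
    distinct i j _ _ eq with i ≟ j
    ... | yes i≡j = i≡j
    ... | no  i≢j = ⊥-elim (proj₂ (proj₂ (proj₂ (blocked i)))
            (subst (h (blocker i) ∈_) (pairwise i j i≢j)
              (x∈p∩q⁺ (inPetal i , subst (λ u → h u ∈ petal j) (sym eq) (inPetal j)))))

  freePetal : ∣ U ∣ < k → ∃ λ i → ∀ u → u ∈ U → h u ∈ petal i → h u ∈ D
  freePetal ∣U∣<k with all? blocked?
  ... | yes blocked = ⊥-elim (<⇒≱ ∣U∣<k (allBlocked⇒k≤∣U∣ blocked))
  ... | no  notAll with ¬∀⟶∃¬ k Blocked blocked? notAll
  ...   | i , unblocked = i , inKernel
    where
    inKernel : ∀ u → u ∈ U → h u ∈ petal i → h u ∈ D
    inKernel u u∈U inP with h u ∈? D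
    ... | yes inD = inD
    ... | no  outD = ⊥-elim (unblocked (u , u∈U , inP , outD))

count : ∀ {n} → Fin n → List (Subset n) → ℕ
count v Ls = length (filter (v ∈?_) Ls)

count-∷-∈ : ∀ {n} {v : Fin n} {E} Ls → v ∈ E → count v (E ∷ Ls) ≡ suc (count v Ls)
count-∷-∈ {v = v} Ls v∈E = cong length (filter-accept (v ∈?_) v∈E)

count-∷-≥ : ∀ {n} (v : Fin n) E Ls → count v Ls ≤ count v (E ∷ Ls)
count-∷-≥ v E Ls with v ∈? E
... | yes _ = n≤1+n _
... | no  _ = ≤-reflexive refl

any⇒count>0 : ∀ {n} {v : Fin n} Ls → Any (v ∈_) Ls → 0 < count v Ls
any⇒count>0 {v = v} (E ∷ Ls) occ with v ∈? E | occ
... | yes _   | _         = s≤s z≤n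
... | no  v∉E | here v∈E  = ⊥-elim (v∉E v∈E)
... | no  _   | there occ' = any⇒count>0 Ls occ'

count>0⇒any : ∀ {n} {v : Fin n} Ls → 0 < count v Ls → Any (v ∈_) Ls
count>0⇒any {v = v} (E ∷ Ls) pos with v ∈? E
... | yes v∈E = here v∈E
... | no  _   = there (count>0⇒any Ls pos)

onlyInHead : ∀ {n} {v : Fin n} {E} Ls → count v (E ∷ Ls) ≤ 1 → v ∈ E → ¬ Any (v ∈_) Ls
onlyInHead Ls atMostOnce v∈E occ =
  n≮0 (≤-trans (any⇒count>0 Ls occ) (s≤s⁻¹ (subst (_≤ 1) (count-∷-∈ Ls v∈E) atMostOnce)))

module _ {r s m : ℕ} (F : Graph r m) (S : Subset s) (f : Fin s → Fin m) where

  -- v is covered by Ls if its image is already determined: v ∉ S, or v lies in an edge of Ls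
  Covered : List (Subset s) → Fin s → Set
  Covered Ls v = v ∉ S ⊎ Any (v ∈_) Ls

  Fresh : List (Subset s) → Subset s → Set
  Fresh pre E = ∀ w → w ∈ E → w ∈ S → ¬ Any (w ∈_) pre

  fresh⇒uncovered : ∀ {pre E} → Fresh pre E → ∀ w → w ∈ E ∩ S → ¬ Covered pre w
  fresh⇒uncovered {E = E} fresh w w∈E∩S (inj₁ w∉S) = w∉S (proj₂ (x∈p∩q⁻ E S w∈E∩S))
  fresh⇒uncovered {E = E} fresh w w∈E∩S (inj₂ occ) =
    fresh w (proj₁ (x∈p∩q⁻ E S w∈E∩S)) (proj₂ (x∈p∩q⁻ E S w∈E∩S)) occ

  newlyCovered : ∀ {pre} E u → Covered (E ∷ pre) u → Covered pre u ⊎ u ∈ E ∩ S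
  newlyCovered E u (inj₁ u∉S)        = inj₁ (inj₁ u∉S)
  newlyCovered E u (inj₂ (there occ)) = inj₁ (inj₂ occ)
  newlyCovered E u (inj₂ (here u∈E)) with u ∈? S
  ... | yes u∈S = inj₂ (x∈p∩q⁺ (u∈E , u∈S))
  ... | no  u∉S = inj₁ (inj₁ u∉S)

  record PartialCopy (Ls : List (Subset s)) (φ : Fin s → Fin m) : Set where
    field
      agrees       : ∀ v → v ∉ S → φ v ≡ f v
      injective    : InjectiveOn (Covered Ls) φ
      edgesToEdges : ∀ E → E ∈ₗ Ls → image φ E ∈ₗ edges F

  extendAlongPetal : ∀ pre φ → PartialCopy pre φ → ∀ E → Fresh pre E →
    ∀ P → P ∈ₗ edges F → image f (E ─ S) ⊆ P → ∣ E ∣ ≡ ∣ P ∣ →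
    (∀ u → Covered pre u → φ u ∈ P → φ u ∈ image f (E ─ S)) →
    Σ (Fin s → Fin m) (PartialCopy (E ∷ pre))
  extendAlongPetal pre φ copy E fresh P P∈F D⊆P ∣E∣≡∣P∣ free =
    ψ , record { agrees = agrees' ; injective = injective' ; edgesToEdges = edgesToEdges' }
    where
    open PartialCopy copy
    D = image f (E ─ S)
    rerouted = rerouteInto (E ∩ S) (P ─ D) (roomForRerouting f E S P ∣E∣≡∣P∣) φ
    ψ : Fin s → Fin m
    ψ = proj₁ rerouted
    open RerouteInto (proj₂ rerouted)

    ψ-old : ∀ u → Covered pre u → ψ u ≡ φ u
    ψ-old u cov = unchangedOff u (λ u∈E∩S → fresh⇒uncovered fresh u u∈E∩S cov)

    agrees' : ∀ v → v ∉ S → ψ v ≡ f v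
    agrees' v v∉S = trans (ψ-old v (inj₁ v∉S)) (agrees v v∉S)

    -- rerouted vertices land in P ∖ D, which no covered vertex reaches
    apart : ∀ u v → Covered pre u → v ∈ E ∩ S → ψ u ≢ ψ v
    apart u v cov v∈E∩S eq =
      x∈p─q⇒x∉q P D inP─D
        (subst (_∈ D) φu≡ψv (free u cov (subst (_∈ P) (sym φu≡ψv) (p─q⊆p P D inP─D))))
      where
      inP─D : ψ v ∈ P ─ D
      inP─D = mapsInto v v∈E∩S
      φu≡ψv : φ u ≡ ψ v
      φu≡ψv = trans (sym (ψ-old u cov)) eq

    injectiveOld : InjectiveOn (Covered pre) ψ
    injectiveOld u v cu cv eq = injective u v cu cv (trans (sym (ψ-old u cu)) (trans eq (ψ-old v cv)))

    injective' : InjectiveOn (Covered (E ∷ pre)) ψ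
    injective' u v cu cv =
      injectiveOn-⊎ ψ injectiveOld injectiveOnA apart u v (newlyCovered E u cu) (newlyCovered E v cv)

    ψ-into-P : ∀ v → v ∈ E → ψ v ∈ P
    ψ-into-P v v∈E with v ∈? S
    ... | yes v∈S = p─q⊆p P D (mapsInto v (x∈p∩q⁺ (v∈E , v∈S)))
    ... | no  v∉S = subst (_∈ P) (sym (agrees' v v∉S))
                      (D⊆P (image-intro f (E ─ S) v (x∈p∧x∉q⇒x∈p─q v∈E v∉S)))

    ψ[E]≡P : image ψ E ≡ P
    ψ[E]≡P = image-onto ψ E P (λ u v u∈E v∈E → injective' u v (inj₂ (here u∈E)) (inj₂ (here v∈E)))
               ψ-into-P (≤-reflexive (sym ∣E∣≡∣P∣))

    edgesToEdges' : ∀ E' → E' ∈ₗ E ∷ pre → image ψ E' ∈ₗ edges F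
    edgesToEdges' E' (here refl)     = subst (_∈ₗ edges F) (sym ψ[E]≡P) P∈F
    edgesToEdges' E' (there E'∈pre) = subst (_∈ₗ edges F)
      (image-cong φ ψ E' (λ v v∈E' → sym (ψ-old v (inj₂ (lose E'∈pre v∈E'))))) (edgesToEdges E' E'∈pre)

  -- Adding one edge E: a petal of the star with kernel D = f(E ∖ S) avoiding the
  -- covered images outside D exists by pigeonhole, since such images come from
  -- vertices outside E, and there are fewer than s ≤ k of those.
  extendByEdge : 0 < r → ∀ pre φ → PartialCopy pre φ → ∀ E → ∣ E ∣ ≡ r →
    Fresh pre E → InKer s F (image f (E ─ S)) →
    Σ (Fin s → Fin m) (PartialCopy (E ∷ pre))
  extendByEdge r>0 pre φ copy E ∣E∣≡r fresh (k , k≥s , st) with freePetal st φ (∁ E) ∣∁E∣<k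
    where
    ∣∁E∣<k : ∣ ∁ E ∣ < k
    ∣∁E∣<k = ≤-trans (subst (_< s) (sym (∣∁p∣≡n∸∣p∣ E))
                        (∸-monoʳ-< (subst (0 <_) (sym ∣E∣≡r) r>0) (∣p∣≤n E))) k≥s
  ... | i , free = extendAlongPetal pre φ copy E fresh (petal i) (petalEdge i) (kernelSub i)
                     (trans ∣E∣≡r (sym (edgeSize F (petalEdge i)))) coveredFree
    where
    open Star st
    open PartialCopy copy
    D = image f (E ─ S)
    coveredFree : ∀ u → Covered pre u → φ u ∈ petal i → φ u ∈ D
    coveredFree u cov inP with u ∈? E | u ∈? S
    ... | no  u∉E | _       = free u (x∉p⇒x∈∁p u∉E) inP
    ... | yes u∈E | no  u∉S = subst (_∈ D) (sym (agrees u u∉S))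
                                (image-intro f (E ─ S) u (x∈p∧x∉q⇒x∈p─q u∈E u∉S))
    ... | yes u∈E | yes u∈S = ⊥-elim (fresh⇒uncovered fresh u (x∈p∩q⁺ (u∈E , u∈S)) cov)

  copyEdges : 0 < r → InjectiveOn (_∉ S) f → ∀ Ls → (∀ {E} → E ∈ₗ Ls → ∣ E ∣ ≡ r) →
    (∀ E → E ∈ₗ Ls → InKer s F (image f (E ─ S))) → (∀ v → v ∈ S → count v Ls ≤ 1) →
    Σ (Fin s → Fin m) (PartialCopy Ls)
  copyEdges r>0 finj [] _ _ _ =
    f , record { agrees = λ _ _ → refl ; injective = injectiveF ; edgesToEdges = λ _ () }
    where
    injectiveF : InjectiveOn (Covered []) f
    injectiveF u v (inj₁ u∉S) (inj₁ v∉S) = finj u v u∉S v∉S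
  copyEdges r>0 finj (E ∷ Ls) sizes kernels once
    with copyEdges r>0 finj Ls (λ E'∈Ls → sizes (there E'∈Ls)) (λ E' E'∈Ls → kernels E' (there E'∈Ls))
                   (λ v v∈S → ≤-trans (count-∷-≥ v E Ls) (once v v∈S))
  ... | φ , copy = extendByEdge r>0 Ls φ copy E (sizes (here refl))
                     (λ w w∈E w∈S → onlyInHead Ls (once w w∈S) w∈E) (kernels E (here refl))

proposition5p3 : (r s m : ℕ) → r ≥ 2 → (G : Graph r s) → (S : Subset s) →
    (∀ v → v ∈ S → degree G v ≡ 1) → (F : Graph r m) → (f : Fin s → Fin m) →
    (∀ u v → u ∉ S → v ∉ S → f u ≡ f v → u ≡ v) →
    (∀ E → E ∈ₗ edges G → InKer s F (image f (E ─ S))) →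
    ContainsCopy F G
proposition5p3 r s m r≥2 G S deg1 F f finj kernels =
  φ , (λ u v → injective u v (allCovered u) (allCovered v)) , edgesToEdges
  where
  copy = copyEdges F S f (≤-trans (s≤s z≤n) r≥2) finj (edges G) (edgeSize G) kernels
           (λ v v∈S → ≤-reflexive (deg1 v v∈S))
  φ : Fin s → Fin m
  φ = proj₁ copy
  open PartialCopy (proj₂ copy)

  -- every vertex of S has degree 1, so lies in some edge of G
  allCovered : ∀ v → Covered F S f (edges G) v
  allCovered v with v ∈? S
  ... | yes v∈S = inj₂ (count>0⇒any (edges G) (≤-reflexive (sym (deg1 v v∈S))))
  ... | no  v∉S = inj₁ v∉S
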